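{- Let $X$ be a finite set of variables and let $s=\langle c_1,c_2\rangle\langle c_3,c_4\rangle\cdots\langle c_{n-1},c_n\rangle$ be a reactive sequence which is strictly increasing with respect to $X$. Then $n\leq |X|+2$.
   Context: Built-in constraints are those of $\mathrm{CHR}(C)$: formulas built from equalities between variables and constants (no function symbols of arity $>0$), $true$, $false$, by conjunction and existential quantification, interpreted in the theory $\mathcal{CT}$ of syntactic equality on the Herbrand universe. A reactive sequence is a finite sequence $\langle a_1,b_1\rangle\cdots\langle a_m,b_m\rangle$ of pairs of built-in constraints satisfying $\mathcal{CT}\models b_j\rightarrow a_j$ for $j\in[1,m]$ and $\mathcal{CT}\models a_{i+1}\rightarrow b_i$ for $i\in[1,m-1]$. Such a sequence is strictly increasing with respect to a set of variables $X$ if for all $j\in[1,m]$ and $i\in[1,m-1]$: $Fv(a_j,b_j)\subseteq X$, $\mathcal{CT}\models b_i\not\rightarrow a_{i+1}$ and $\mathcal{CT}\models a_i\not\rightarrow b_i$. -}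

module Defs where

open import Level using (Level; _⊔_; suc)
open import Data.Nat using (ℕ; _≟_)
open import Data.Vec using (Vec; [])
open import Data.List using (List; []; _∷_)
open import Data.List.Membership.Propositional using (_∈_)
open import Data.Product using (Σ; _×_; _,_)
open import Data.Unit using (⊤)
open import Data.Empty using (⊥)
open import Relation.Nullary using (¬_; yes; no)
open import Relation.Binary.PropositionalEquality using (_≡_; _≢_; subst; sym)

Var : Set
Var = ℕ

record Signature : Set₁ where
  field
    Fun   : Set
    arity : Fun → ℕ
open Signature public

module _ (Σg : Signature) where

  data HU : Set where
    app : (f : Fun Σg) → Vec HU (arity Σg f) → HU

  data Term : Set where
    var : Var → Term
    cst : (f : Fun Σg) → arity Σg f ≡ 0 → Term

  data Constraint : Set where
    ctrue  : Constraint
    cfalse : Constraint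
    _≐_    : Term → Term → Constraint
    _∧_    : Constraint → Constraint → Constraint
    ∃[_]_  : Var → Constraint → Constraint

  Valuation : Set
  Valuation = Var → HU

  update : Valuation → Var → HU → Valuation
  update σ x v y with y ≟ x
  ... | yes _ = v
  ... | no  _ = σ y

  evalT : Valuation → Term → HU
  evalT σ (var x)   = σ x
  evalT σ (cst f p) = app f (subst (Vec HU) (sym p) [])

  -- Satisfaction in the Herbrand model of syntactic equality (CT).
  Sat : Valuation → Constraint → Set
  Sat σ ctrue    = ⊤
  Sat σ cfalse   = ⊥
  Sat σ (s ≐ t)  = evalT σ s ≡ evalT σ t
  Sat σ (c ∧ d)  = Sat σ c × Sat σ d
  Sat σ (∃[ x ] c) = Σ HU (λ v → Sat (update σ x v) c)

  _⊨_ : Constraint → Constraint → Set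
  c ⊨ d = (σ : Valuation) → Sat σ c → Sat σ d

  data FreeT (x : Var) : Term → Set where
    here : FreeT x (var x)

  data Free (x : Var) : Constraint → Set where
    eqˡ  : ∀ {s t} → FreeT x s → Free x (s ≐ t)
    eqʳ  : ∀ {s t} → FreeT x t → Free x (s ≐ t)
    andˡ : ∀ {c d} → Free x c → Free x (c ∧ d)
    andʳ : ∀ {c d} → Free x d → Free x (c ∧ d)
    ex   : ∀ {y c} → x ≢ y → Free x c → Free x (∃[ y ] c)

  FvSub : Constraint → Constraint → List Var → Set
  FvSub a b X = ∀ x → (Free x a → x ∈ X) × (Free x b → x ∈ X)

  LinkedR : Constraint → List (Constraint × Constraint) → Set
  LinkedR b []             = ⊤
  LinkedR b ((a′ , _) ∷ _) = a′ ⊨ b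

  Reactive : List (Constraint × Constraint) → Set
  Reactive []             = ⊤
  Reactive ((a , b) ∷ s)  = (b ⊨ a) × LinkedR b s × Reactive s

  LinkedS : Constraint → List (Constraint × Constraint) → Set
  LinkedS b []             = ⊤
  LinkedS b ((a′ , _) ∷ _) = ¬ (b ⊨ a′)

  StrictlyIncreasing : List Var → List (Constraint × Constraint) → Set
  StrictlyIncreasing X []            = ⊤
  StrictlyIncreasing X ((a , b) ∷ s) =
    FvSub a b X × ¬ (a ⊨ b) × LinkedS b s × StrictlyIncreasing X s

-- A satisfiable constraint d whose free variables lie in X is determined by the equalities it
-- forces among those variables and between them and values: any valuation satisfying these
-- satisfies d.  For an existential ∃z.e the witness is the value, or the free variable, that e
-- forces z to be, and an arbitrary value if there is none.
--
-- Count the variables of X that d forces to a value or to a later variable of X.  The count lies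
-- between 0 and |X|, cannot decrease along entailment, and, by the determination above, strictly
-- increases from c to d whenever d ⊨ c, c ⊭ d and d is satisfiable.  In the chain a₁ b₁ … a_m b_m
-- of a strictly increasing reactive sequence only the last constraint can be unsatisfiable (an
-- unsatisfiable one entails its successor), so the counts of the first 2m − 1 constraints
-- strictly increase and 2m − 2 ≤ |X|.  The case splits are classical, which is harmless as
-- the conclusion is decidable.

module Submission where

open import Defs
open import Data.Nat using (ℕ; suc; _≤_; _<_; _+_; _*_; z≤n; s≤s; _≤?_; _<?_; _≟_)
open import Data.Nat.Properties using (≤-trans; m≤n⇒m≤1+n; +-suc; +-comm; +-monoʳ-≤; m+n≤o⇒m≤o; *-suc)
open import Data.List using (List; []; _∷_; length)
open import Data.List.Relation.Unary.All using (All; []; _∷_; tail)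
open import Data.List.Relation.Unary.Any using (here; there)
open import Data.List.Relation.Unary.Unique.Propositional using (Unique)
open import Data.List.Membership.Propositional using (_∈_)
open import Data.Product using (Σ; ∃; _×_; _,_; proj₁; proj₂)
open import Data.Sum using (_⊎_; inj₁; inj₂)
import Data.Sum as Sum
open import Data.Unit using (⊤; tt)
open import Function using (_∘_)
open import Level using (0ℓ)
open import Effect.Monad using (RawMonad)
open import Relation.Nullary using (¬_; Dec; yes; no; contradiction)
open import Relation.Nullary.Decidable using (¬¬-excluded-middle; decidable-stable)
open import Relation.Nullary.Negation using (¬¬-Monad)
open import Relation.Binary.PropositionalEquality using (_≡_; _≢_; refl; sym; trans; cong; subst; subst₂)

open RawMonad (¬¬-Monad {a = 0ℓ}) using (return; _>>=_)

module _ (Σg : Signature) where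

  Val : Set
  Val = Valuation Σg

  Con : Set
  Con = Constraint Σg

  infix 4 _⊩_ _⊨ᶜ_ _⊨_≈_ _⊨_↦_

  _⊩_ : Val → Con → Set
  σ ⊩ c = Sat Σg σ c

  _⊨ᶜ_ : Con → Con → Set
  c ⊨ᶜ d = _⊨_ Σg c d

  _⊨_≈_ : Con → Var → Var → Set
  c ⊨ x ≈ y = ∀ σ → σ ⊩ c → σ x ≡ σ y

  _⊨_↦_ : Con → Var → HU Σg → Set
  c ⊨ x ↦ v = ∀ σ → σ ⊩ c → σ x ≡ v

  update-≢ : ∀ σ {x y} v → y ≢ x → update Σg σ x v y ≡ σ y
  update-≢ σ {x} {y} v y≢x with y ≟ x
  ... | yes y≡x = contradiction y≡x y≢x
  ... | no _    = refl

  ≈-sym : ∀ {c x y} → c ⊨ x ≈ y → c ⊨ y ≈ x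
  ≈-sym x≈y σ σ⊩c = sym (x≈y σ σ⊩c)

  ≈-trans : ∀ {c x y z} → c ⊨ x ≈ y → c ⊨ y ≈ z → c ⊨ x ≈ z
  ≈-trans x≈y y≈z σ σ⊩c = trans (x≈y σ σ⊩c) (y≈z σ σ⊩c)

  ↦-resp-≈ : ∀ {c x y v} → c ⊨ x ≈ y → c ⊨ y ↦ v → c ⊨ x ↦ v
  ↦-resp-≈ x≈y y↦v σ σ⊩c = trans (x≈y σ σ⊩c) (y↦v σ σ⊩c)

  ≈-from-↦ : ∀ {c x y v} → c ⊨ x ↦ v → c ⊨ y ↦ v → c ⊨ x ≈ y
  ≈-from-↦ x↦v y↦v σ σ⊩c = trans (x↦v σ σ⊩c) (sym (y↦v σ σ⊩c))

  ≈-strengthen : ∀ {c d x y} → d ⊨ᶜ c → c ⊨ x ≈ y → d ⊨ x ≈ y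
  ≈-strengthen d⊨c x≈y σ σ⊩d = x≈y σ (d⊨c σ σ⊩d)

  ↦-strengthen : ∀ {c d x v} → d ⊨ᶜ c → c ⊨ x ↦ v → d ⊨ x ↦ v
  ↦-strengthen d⊨c x↦v σ σ⊩d = x↦v σ (d⊨c σ σ⊩d)

  ≈-∃ : ∀ {z e x y} → x ≢ z → y ≢ z → e ⊨ x ≈ y → ∃[ z ] e ⊨ x ≈ y
  ≈-∃ x≢z y≢z x≈y σ (v , σ′⊩e) =
    trans (sym (update-≢ σ v x≢z)) (trans (x≈y _ σ′⊩e) (update-≢ σ v y≢z))

  ↦-∃ : ∀ {z e x v} → x ≢ z → e ⊨ x ↦ v → ∃[ z ] e ⊨ x ↦ v
  ↦-∃ x≢z x↦v σ (w , σ′⊩e) = trans (sym (update-≢ σ w x≢z)) (x↦v _ σ′⊩e)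

  ↦-functional : ∀ {d σ₀ x v w} → σ₀ ⊩ d → d ⊨ x ↦ v → d ⊨ x ↦ w → v ≡ w
  ↦-functional {σ₀ = σ₀} σ₀⊩d x↦v x↦w = trans (sym (x↦v σ₀ σ₀⊩d)) (x↦w σ₀ σ₀⊩d)

  Pinned : Con → Var → Set
  Pinned e z = Σ (HU Σg) (e ⊨ z ↦_)

  Aliased : Con → Var → Set
  Aliased e z = ∃ λ y → Free Σg y e × y ≢ z × e ⊨ z ≈ y

  -- The classical case split behind the witness of each existential; it does not depend on
  -- the valuation, so it may be made once and for all under a double negation.
  Forcing : Con → Set
  Forcing (c ∧ e)    = Forcing c × Forcing e
  Forcing (∃[ z ] e) = Dec (Pinned e z) × Dec (Aliased e z) × Forcing e
  Forcing _          = ⊤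

  forcing : ∀ d → ¬ ¬ Forcing d
  forcing ctrue      = return tt
  forcing cfalse     = return tt
  forcing (_ ≐ _)    = return tt
  forcing (c ∧ e)    = do
    fc ← forcing c
    fe ← forcing e
    return (fc , fe)
  forcing (∃[ z ] e) = do
    pinned?  ← ¬¬-excluded-middle
    aliased? ← ¬¬-excluded-middle
    fe       ← forcing e
    return (pinned? , aliased? , fe)

  record Respects (d : Con) (τ : Val) : Set where
    field
      respects-≈ : ∀ {x y} → Free Σg x d → Free Σg y d → d ⊨ x ≈ y → τ x ≡ τ y
      respects-↦ : ∀ {x v} → Free Σg x d → d ⊨ x ↦ v → τ x ≡ v
  open Respects

  respects-∧ˡ : ∀ {c e τ} → Respects (c ∧ e) τ → Respects c τ
  respects-∧ˡ r = record
    { respects-≈ = λ fx fy x≈y → respects-≈ r (andˡ fx) (andˡ fy) (λ σ → x≈y σ ∘ proj₁)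
    ; respects-↦ = λ fx x↦v → respects-↦ r (andˡ fx) (λ σ → x↦v σ ∘ proj₁)
    }

  respects-∧ʳ : ∀ {c e τ} → Respects (c ∧ e) τ → Respects e τ
  respects-∧ʳ r = record
    { respects-≈ = λ fx fy x≈y → respects-≈ r (andʳ fx) (andʳ fy) (λ σ → x≈y σ ∘ proj₂)
    ; respects-↦ = λ fx x↦v → respects-↦ r (andʳ fx) (λ σ → x↦v σ ∘ proj₂)
    }

  witness : ∀ e z → Dec (Pinned e z) → Dec (Aliased e z) → Val → HU Σg
  witness e z (yes (v , _)) _             τ = v
  witness e z (no _)        (yes (y , _)) τ = τ y
  witness e z (no _)        (no _)        τ = τ z  -- any value would do

  module _ {z e τ} (r : Respects (∃[ z ] e) τ) where

    witness-≈ : ∀ (p? : Dec (Pinned e z)) (a? : Dec (Aliased e z)) {y} →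
                Free Σg y e → y ≢ z → e ⊨ z ≈ y → witness e z p? a? τ ≡ τ y
    witness-≈ p? a? {y} fy y≢z z≈y with p? | a?
    ... | yes (v , z↦v) | _ =
      sym (respects-↦ r (ex y≢z fy) (↦-∃ y≢z (↦-resp-≈ (≈-sym z≈y) z↦v)))
    ... | no _ | yes (y₀ , fy₀ , y₀≢z , z≈y₀) =
      respects-≈ r (ex y₀≢z fy₀) (ex y≢z fy) (≈-∃ y₀≢z y≢z (≈-trans (≈-sym z≈y₀) z≈y))
    ... | no _ | no ¬aliased = contradiction (y , fy , y≢z , z≈y) ¬aliased

    witness-↦ : ∀ (p? : Dec (Pinned e z)) (a? : Dec (Aliased e z)) {σ₀ v} →
                σ₀ ⊩ e → e ⊨ z ↦ v → witness e z p? a? τ ≡ v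
    witness-↦ p? a? {σ₀} σ₀⊩e z↦v with p?
    ... | yes (w , z↦w) = trans (sym (z↦w σ₀ σ₀⊩e)) (z↦v σ₀ σ₀⊩e)
    ... | no ¬pinned    = contradiction (_ , z↦v) ¬pinned

    respects-update : ∀ (p? : Dec (Pinned e z)) (a? : Dec (Aliased e z)) {σ₀} →
                      σ₀ ⊩ e → Respects e (update Σg τ z (witness e z p? a? τ))
    respects-update p? a? σ₀⊩e = record { respects-≈ = respects-≈′ ; respects-↦ = respects-↦′ }
      where
      w : HU Σg
      w = witness e z p? a? τ
      τ′ : Val
      τ′ = update Σg τ z w

      respects-≈′ : ∀ {x y} → Free Σg x e → Free Σg y e → e ⊨ x ≈ y → τ′ x ≡ τ′ y
      -- Matching on x ≟ z also evaluates τ′ x, since update is defined by the same test.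
      respects-≈′ {x} {y} fx fy x≈y with x ≟ z | y ≟ z
      ... | yes refl | yes refl = refl
      ... | yes refl | no y≢z   = witness-≈ p? a? fy y≢z x≈y
      ... | no x≢z   | yes refl = sym (witness-≈ p? a? fx x≢z (≈-sym x≈y))
      ... | no x≢z   | no y≢z   = respects-≈ r (ex x≢z fx) (ex y≢z fy) (≈-∃ x≢z y≢z x≈y)

      respects-↦′ : ∀ {x v} → Free Σg x e → e ⊨ x ↦ v → τ′ x ≡ v
      respects-↦′ {x} fx x↦v with x ≟ z
      ... | yes refl = witness-↦ p? a? σ₀⊩e x↦v
      ... | no x≢z   = respects-↦ r (ex x≢z fx) (↦-∃ x≢z x↦v)

  respects⇒⊩ : ∀ d → Forcing d → ∀ {σ₀ τ} → σ₀ ⊩ d → Respects d τ → τ ⊩ d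
  respects⇒⊩ ctrue               _ _    _ = tt
  respects⇒⊩ (var x ≐ var y)     _ _    r = respects-≈ r (eqˡ here) (eqʳ here) (λ _ x≡y → x≡y)
  respects⇒⊩ (var x ≐ cst f p)   _ _    r = respects-↦ r (eqˡ here) (λ _ x≡v → x≡v)
  respects⇒⊩ (cst f p ≐ var y)   _ _    r = sym (respects-↦ r (eqʳ here) (λ _ v≡y → sym v≡y))
  respects⇒⊩ (cst f p ≐ cst g q) _ σ₀⊩d _ = σ₀⊩d
  respects⇒⊩ (c ∧ e) (fc , fe) (σ₀⊩c , σ₀⊩e) r =
    respects⇒⊩ c fc σ₀⊩c (respects-∧ˡ r) , respects⇒⊩ e fe σ₀⊩e (respects-∧ʳ r)
  respects⇒⊩ (∃[ z ] e) (p? , a? , fe) {τ = τ} (_ , σ₀′⊩e) r =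
    witness e z p? a? τ , respects⇒⊩ e fe σ₀′⊩e (respects-update r p? a? σ₀′⊩e)

  Scoped : List Var → Con → Set
  Scoped X d = ∀ {x} → Free Σg x d → x ∈ X

  Determined : Con → List Var → Var → Set
  Determined c xs x = Pinned c x ⊎ ∃ λ y → y ∈ xs × c ⊨ y ≈ x

  determined-strengthen : ∀ {c d xs x} → d ⊨ᶜ c → Determined c xs x → Determined d xs x
  determined-strengthen d⊨c (inj₁ (v , x↦v))      = inj₁ (v , ↦-strengthen d⊨c x↦v)
  determined-strengthen d⊨c (inj₂ (y , y∈ , y≈x)) = inj₂ (y , y∈ , ≈-strengthen d⊨c y≈x)

  data Rank (c : Con) : List Var → ℕ → Set where
    []   : Rank c [] 0
    det  : ∀ {x xs n} → Determined c xs x → Rank c xs n → Rank c (x ∷ xs) (suc n)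
    free : ∀ {x xs n} → ¬ Determined c xs x → Rank c xs n → Rank c (x ∷ xs) n

  rank : ∀ c xs → ¬ ¬ ∃ (Rank c xs)
  rank c []       = return (0 , [])
  rank c (x ∷ xs) = do
    (n , r) ← rank c xs
    det?    ← ¬¬-excluded-middle
    return (extend det? r)
    where
    extend : ∀ {n} → Dec (Determined c xs x) → Rank c xs n → ∃ (Rank c (x ∷ xs))
    extend (yes dx) r = _ , det dx r
    extend (no ¬dx) r = _ , free ¬dx r

  rank≤length : ∀ {c xs n} → Rank c xs n → n ≤ length xs
  rank≤length []         = z≤n
  rank≤length (det _ r)  = s≤s (rank≤length r)
  rank≤length (free _ r) = m≤n⇒m≤1+n (rank≤length r)

  rank-mono : ∀ {c d xs m n} → d ⊨ᶜ c → Rank c xs m → Rank d xs n → m ≤ n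
  rank-mono d⊨c []           []            = z≤n
  rank-mono d⊨c (det _ rc)   (det _ rd)    = s≤s (rank-mono d⊨c rc rd)
  rank-mono d⊨c (det dc _)   (free ¬dd _)  = contradiction (determined-strengthen d⊨c dc) ¬dd
  rank-mono d⊨c (free _ rc)  (det _ rd)    = m≤n⇒m≤1+n (rank-mono d⊨c rc rd)
  rank-mono d⊨c (free _ rc)  (free _ rd)   = rank-mono d⊨c rc rd

  record Inherits (c d : Con) (xs : List Var) : Set where
    field
      inherits-≈ : ∀ {x y} → x ∈ xs → y ∈ xs → d ⊨ x ≈ y → c ⊨ x ≈ y
      inherits-↦ : ∀ {x v} → x ∈ xs → d ⊨ x ↦ v → c ⊨ x ↦ v
  open Inherits

  module _ {c d σ₀} (d⊨c : d ⊨ᶜ c) (σ₀⊩d : σ₀ ⊩ d) where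

    inherits-∷ : ∀ {x xs} → Inherits c d xs → (Determined d xs x → Determined c xs x) →
                 Inherits c d (x ∷ xs)
    inherits-∷ {x} {xs} i d⇒c = record { inherits-≈ = inherits-≈′ ; inherits-↦ = inherits-↦′ }
      where
      ≈-new : ∀ {y} → y ∈ xs → d ⊨ y ≈ x → c ⊨ y ≈ x
      ≈-new y∈ y≈x with d⇒c (inj₂ (_ , y∈ , y≈x))
      ... | inj₁ (v , x↦v) =
        ≈-from-↦ (inherits-↦ i y∈ (↦-resp-≈ y≈x (↦-strengthen d⊨c x↦v))) x↦v
      ... | inj₂ (z , z∈ , z≈x) =
        ≈-trans (inherits-≈ i y∈ z∈ (≈-trans y≈x (≈-sym (≈-strengthen d⊨c z≈x)))) z≈x

      ↦-new : ∀ {v} → d ⊨ x ↦ v → c ⊨ x ↦ v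
      ↦-new x↦v with d⇒c (inj₁ (_ , x↦v))
      ... | inj₁ (w , x↦w) =
        subst (c ⊨ x ↦_) (↦-functional σ₀⊩d (↦-strengthen d⊨c x↦w) x↦v) x↦w
      ... | inj₂ (z , z∈ , z≈x) =
        ↦-resp-≈ (≈-sym z≈x) (inherits-↦ i z∈ (↦-resp-≈ (≈-strengthen d⊨c z≈x) x↦v))

      inherits-≈′ : ∀ {y z} → y ∈ x ∷ xs → z ∈ x ∷ xs → d ⊨ y ≈ z → c ⊨ y ≈ z
      inherits-≈′ (here refl) (here refl) _   = λ _ _ → refl
      inherits-≈′ (here refl) (there z∈)  x≈z = ≈-sym (≈-new z∈ (≈-sym x≈z))
      inherits-≈′ (there y∈)  (here refl) y≈x = ≈-new y∈ y≈x
      inherits-≈′ (there y∈)  (there z∈)      = inherits-≈ i y∈ z∈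

      inherits-↦′ : ∀ {y v} → y ∈ x ∷ xs → d ⊨ y ↦ v → c ⊨ y ↦ v
      inherits-↦′ (here refl) = ↦-new
      inherits-↦′ (there y∈)  = inherits-↦ i y∈

    rank-compare : ∀ {xs m n} → Rank c xs m → Rank d xs n → m < n ⊎ Inherits c d xs
    rank-compare [] [] = inj₂ (record { inherits-≈ = λ () ; inherits-↦ = λ () })
    rank-compare (det dc rc) (det _ rd) =
      Sum.map s≤s (λ i → inherits-∷ i (λ _ → dc)) (rank-compare rc rd)
    rank-compare (det dc _) (free ¬dd _) = contradiction (determined-strengthen d⊨c dc) ¬dd
    rank-compare (free _ rc) (det _ rd) = inj₁ (s≤s (rank-mono d⊨c rc rd))
    rank-compare (free _ rc) (free ¬dd rd) =
      Sum.map₂ (λ i → inherits-∷ i (λ dd → contradiction dd ¬dd)) (rank-compare rc rd)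

    inherits⇒⊨ : ∀ {X} → Forcing d → Scoped X d → Inherits c d X → c ⊨ᶜ d
    inherits⇒⊨ fd scoped i τ τ⊩c = respects⇒⊩ d fd σ₀⊩d (record
      { respects-≈ = λ fx fy x≈y → inherits-≈ i (scoped fx) (scoped fy) x≈y τ τ⊩c
      ; respects-↦ = λ fx x↦v → inherits-↦ i (scoped fx) x↦v τ τ⊩c
      })

    rank-strict : ∀ {X m n} → Scoped X d → ¬ (c ⊨ᶜ d) → Rank c X m → Rank d X n → m < n
    rank-strict scoped c⋫d rc rd = decidable-stable (_ <? _) do
      fd ← forcing d
      Sum.[ return , (λ i → contradiction (inherits⇒⊨ fd scoped i) c⋫d) ] (rank-compare rc rd)

  StrictChain : List Con → Set
  StrictChain (c ∷ d ∷ cs) = d ⊨ᶜ c × ¬ (c ⊨ᶜ d) × StrictChain (d ∷ cs)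
  StrictChain _            = ⊤

  satisfiable : ∀ {d e} → ¬ (d ⊨ᶜ e) → ¬ ¬ ∃ (_⊩ d)
  satisfiable d⋫e unsat = d⋫e (λ σ σ⊩d → contradiction (σ , σ⊩d) unsat)

  chain-bound : ∀ {X c d m} cs → StrictChain (c ∷ d ∷ cs) → All (Scoped X) (d ∷ cs) →
                Rank c X m → length cs + m ≤ length X
  chain-bound [] _ _ rc = rank≤length rc
  chain-bound {X} {d = d} {m} (e ∷ cs) (d⊨c , c⋫d , chain@(_ , d⋫e , _)) (scoped ∷ scopeds) rc =
    decidable-stable (_ ≤? _) do
      (σ₀ , σ₀⊩d) ← satisfiable d⋫e
      (n , rd)    ← rank d X
      let m<n = rank-strict d⊨c σ₀⊩d scoped c⋫d rc rd
      return (subst (_≤ length X) (+-suc (length cs) m)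
                (≤-trans (+-monoʳ-≤ (length cs) m<n) (chain-bound cs chain scopeds rd)))

  flatten : List (Con × Con) → List Con
  flatten []            = []
  flatten ((a , b) ∷ s) = a ∷ b ∷ flatten s

  length-flatten : ∀ s → length (flatten s) ≡ 2 * length s
  length-flatten []            = refl
  length-flatten ((a , b) ∷ s) = trans (cong (2 +_) (length-flatten s)) (sym (*-suc 2 (length s)))

  strictChain-flatten : ∀ {X b} s → LinkedR Σg b s → LinkedS Σg b s → Reactive Σg s →
                        StrictlyIncreasing Σg X s → StrictChain (b ∷ flatten s)
  strictChain-flatten []             _      _      _                       _ = tt
  strictChain-flatten ((a , b) ∷ s) a⊨b′ b′⋫a (b⊨a , linkR , reactive) (_ , a⋫b , linkS , si) =
    a⊨b′ , b′⋫a , b⊨a , a⋫b , strictChain-flatten s linkR linkS reactive si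

  scoped-flatten : ∀ {X} s → StrictlyIncreasing Σg X s → All (Scoped X) (flatten s)
  scoped-flatten []            _               = []
  scoped-flatten ((a , b) ∷ s) (fv , _ , _ , si) =
    proj₁ (fv _) ∷ proj₂ (fv _) ∷ scoped-flatten s si

lemma15 : (Σg : Signature) (X : List Var) → Unique X →
    (s : List (Constraint Σg × Constraint Σg)) →
    Reactive Σg s → StrictlyIncreasing Σg X s →
    2 * length s ≤ length X + 2
lemma15 Σg X _ []            _                          _                             = z≤n
lemma15 Σg X _ ((a , b) ∷ s) (b⊨a , linkR , reactive) si@(_ , a⋫b , linkS , si′) =
  decidable-stable (_ ≤? _) do
    (m , ra) ← rank Σg a X
    let chain = b⊨a , a⋫b , strictChain-flatten Σg s linkR linkS reactive si′
        bound = chain-bound Σg (flatten Σg s) chain (tail (scoped-flatten Σg _ si)) ra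
    return (subst₂ _≤_ (length-flatten Σg ((a , b) ∷ s)) (+-comm 2 (length X))
              (s≤s (s≤s (m+n≤o⇒m≤o _ bound))))
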